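{- Let $\mathfrak{A}$ be a first-order structure with vocabulary $\tau$ and universe $A$, and let $\mathcal{T}$ be a topology on $A$ such that every relation symbol $R\in\tau$ of arity $n$ is interpreted as an open subset of $A^n$ and every function symbol $f\in\tau$ of arity $n$ is interpreted as a continuous function, with respect to the product topology on $A^n$ induced by $\mathcal{T}$. Let $D$ be a dense subset of $A$ in the topology $\mathcal{T}$, and let $\phi(\bar{x})$ be an existential first-order formula over $\tau$ with free variables among $\bar{x}$. Then $\phi$ is satisfiable in $\mathfrak{A}$ if and only if $\mathfrak{A}\models\phi(\bar{a})$ for some tuple $\bar{a}$ of elements of $D$.
   Context: Existential first-order formulae over $\tau$ are generated from atomic formulae using only $\land$, $\lor$ and $\exists$ (no negation, no universal quantification). A set $D\subseteq A$ is dense if it intersects every non-empty open subset of $A$. -}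

module Defs where

open import Data.Nat using (ℕ; suc)
open import Data.Fin using (Fin)
open import Data.Product using (Σ; ∃; _×_)
open import Data.Sum using (_⊎_)
open import Data.Vec.Functional using (_∷_)
open import Data.Unit using (⊤)

Subset : Set → Set₁
Subset A = A → Set

record Topology (A : Set) : Set₁ where
  field
    Open       : Subset A → Set
    whole-open : Open (λ _ → ⊤)
    ∩-open     : ∀ {U V} → Open U → Open V → Open (λ a → U a × V a)
    ⋃-open     : (I : Set) (U : I → Subset A) → (∀ i → Open (U i))
               → Open (λ a → ∃ λ i → U i a)
  -- extensionality: open sets are closed under pointwise equivalence
    open-≐     : ∀ {U V} → (∀ a → U a → V a) → (∀ a → V a → U a)
               → Open U → Open V

open Topology public

-- Product topology on A^n = (Fin n → A): U is open iff every point of U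
-- lies in an open box ∏ Vᵢ (Vᵢ open in A) contained in U.
ProdOpen : {A : Set} → Topology A → (n : ℕ) → Subset (Fin n → A) → Set₁
ProdOpen T n U =
  ∀ x → U x → Σ (Fin n → Subset _) λ V →
    (∀ i → Open T (V i)) × (∀ i → V i (x i)) ×
    (∀ y → (∀ i → V i (y i)) → U y)

Continuous : {A : Set} → Topology A → {n : ℕ} → ((Fin n → A) → A) → Set₁
Continuous T {n} f = ∀ U → Open T U → ProdOpen T n (λ x → U (f x))

Dense : {A : Set} → Topology A → Subset A → Set₁
Dense T D = ∀ U → Open T U → (∃ λ a → U a) → ∃ λ d → D d × U d

record Vocabulary : Set₁ where
  field
    RelSym  : Set
    relAr   : RelSym → ℕ
    FunSym  : Set
    funAr   : FunSym → ℕ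

open Vocabulary public

record Structure (τ : Vocabulary) : Set₁ where
  field
    Carrier : Set
    relI    : (R : RelSym τ) → Subset (Fin (relAr τ R) → Carrier)
    funI    : (f : FunSym τ) → (Fin (funAr τ f) → Carrier) → Carrier

open Structure public

data Term (τ : Vocabulary) (k : ℕ) : Set where
  var : Fin k → Term τ k
  app : (f : FunSym τ) → (Fin (funAr τ f) → Term τ k) → Term τ k

data ExFormula (τ : Vocabulary) : ℕ → Set where
  atom : ∀ {k} (R : RelSym τ) → (Fin (relAr τ R) → Term τ k) → ExFormula τ k
  _∧_  : ∀ {k} → ExFormula τ k → ExFormula τ k → ExFormula τ k
  _∨_  : ∀ {k} → ExFormula τ k → ExFormula τ k → ExFormula τ k
  ex   : ∀ {k} → ExFormula τ (suc k) → ExFormula τ k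

module _ {τ : Vocabulary} (𝔄 : Structure τ) where

  eval : ∀ {k} → (Fin k → Carrier 𝔄) → Term τ k → Carrier 𝔄
  eval ρ (var i)    = ρ i
  eval ρ (app f ts) = funI 𝔄 f (λ i → eval ρ (ts i))

  -- Sat φ ρ  means  𝔄 ⊨ φ[ρ]  (under ex, the new bound variable is index 0)
  Sat : ∀ {k} → ExFormula τ k → (Fin k → Carrier 𝔄) → Set
  Sat (atom R ts) ρ = relI 𝔄 R (λ i → eval ρ (ts i))
  Sat (φ ∧ ψ)     ρ = Sat φ ρ × Sat ψ ρ
  Sat (φ ∨ ψ)     ρ = Sat φ ρ ⊎ Sat ψ ρ
  Sat (ex φ)      ρ = Σ (Carrier 𝔄) λ a → Sat φ (a ∷ ρ)

-- Satisfaction of an existential formula is an open condition on the tuple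
-- of values of its free variables: atomic formulas are preimages of open
-- relations under continuous term functions, and ∧, ∨, ∃ preserve openness
-- (∃ because the section y ↦ (a , y) of a projection is continuous).
-- A satisfying tuple therefore has an open box of satisfying tuples around
-- it, and density of D in each coordinate yields a satisfying tuple from D.
module Submission where

open import Defs
open import Data.Nat using (ℕ; zero; suc)
open import Data.Fin using (Fin; zero; suc; _≟_)
open import Data.Product using (Σ; _×_; _,_; proj₁; proj₂)
open import Data.Sum using (inj₁; inj₂)
open import Data.Unit using (⊤; tt)
open import Data.Empty using (⊥-elim)
open import Data.Vec.Functional using (_∷_)
open import Relation.Nullary using (yes; no)
open import Relation.Binary.PropositionalEquality using (refl)
open import Function.Bundles using (_⇔_; mk⇔)

module _ {A : Set} (T : Topology A) where

  -- ProdOpen T k U  is definitionally  ∀ x → U x → BoxNbhd x U.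
  BoxNbhd : {k : ℕ} → (Fin k → A) → Subset (Fin k → A) → Set₁
  BoxNbhd {k} x U = Σ (Fin k → Subset A) λ V →
    (∀ i → Open T (V i)) × (∀ i → V i (x i)) ×
    (∀ y → (∀ i → V i (y i)) → U y)

  ContinuousAt : {k : ℕ} → ((Fin k → A) → A) → (Fin k → A) → Set₁
  ContinuousAt g x = ∀ U → Open T U → U (g x) → BoxNbhd x (λ y → U (g y))

  BoxNbhd-mono : ∀ {k} {x : Fin k → A} {S S′ : Subset (Fin k → A)} →
                 (∀ y → S y → S′ y) → BoxNbhd x S → BoxNbhd x S′
  BoxNbhd-mono S⊆S′ (V , open-V , x∈V , V⊆S) =
    V , open-V , x∈V , λ y y∈V → S⊆S′ y (V⊆S y y∈V)

  BoxNbhd-univ : ∀ {k} {x : Fin k → A} → BoxNbhd x (λ _ → ⊤)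
  BoxNbhd-univ = (λ _ _ → ⊤) , (λ _ → whole-open T) , (λ _ → tt) , λ _ _ → tt

  BoxNbhd-∩ : ∀ {k} {x : Fin k → A} {S S′ : Subset (Fin k → A)} →
              BoxNbhd x S → BoxNbhd x S′ → BoxNbhd x (λ y → S y × S′ y)
  BoxNbhd-∩ (V , open-V , x∈V , V⊆S) (V′ , open-V′ , x∈V′ , V′⊆S′) =
    (λ i a → V i a × V′ i a) , (λ i → ∩-open T (open-V i) (open-V′ i)) ,
    (λ i → x∈V i , x∈V′ i) ,
    λ y y∈W → V⊆S y (λ i → proj₁ (y∈W i)) , V′⊆S′ y (λ i → proj₂ (y∈W i))

  BoxNbhd-⋂ : ∀ {k} {x : Fin k → A} (m : ℕ) (S : Fin m → Subset (Fin k → A)) →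
              (∀ l → BoxNbhd x (S l)) → BoxNbhd x (λ y → ∀ l → S l y)
  BoxNbhd-⋂ zero    S nbhd = BoxNbhd-mono (λ _ _ ()) BoxNbhd-univ
  BoxNbhd-⋂ (suc m) S nbhd =
    BoxNbhd-mono (λ { y (y∈S₀ , y∈S₊) zero → y∈S₀ ; y (y∈S₀ , y∈S₊) (suc l) → y∈S₊ l })
      (BoxNbhd-∩ (nbhd zero) (BoxNbhd-⋂ m (λ l → S (suc l)) (λ l → nbhd (suc l))))

  BoxNbhd-section : ∀ {k} {x : Fin k → A} {a : A} {S : Subset (Fin (suc k) → A)} →
                    BoxNbhd (a ∷ x) S → BoxNbhd x (λ y → S (a ∷ y))
  BoxNbhd-section (V , open-V , ax∈V , V⊆S) =
    (λ i → V (suc i)) , (λ i → open-V (suc i)) , (λ i → ax∈V (suc i)) ,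
    λ y y∈V₊ → V⊆S (_ ∷ y) λ { zero → ax∈V zero ; (suc i) → y∈V₊ i }

  projection-continuousAt : ∀ {k} (i : Fin k) (x : Fin k → A) →
                            ContinuousAt (λ y → y i) x
  projection-continuousAt i x U open-U xᵢ∈U = V , open-V , x∈V , V⊆U
    where
    V : Fin _ → Subset A
    V j with j ≟ i
    ... | yes _ = U
    ... | no _  = λ _ → ⊤
    open-V : ∀ j → Open T (V j)
    open-V j with j ≟ i
    ... | yes _ = open-U
    ... | no _  = whole-open T
    x∈V : ∀ j → V j (x j)
    x∈V j with j ≟ i
    ... | yes refl = xᵢ∈U
    ... | no _     = tt
    V⊆U : ∀ y → (∀ j → V j (y j)) → U (y i)
    V⊆U y y∈V with i ≟ i | y∈V i
    ... | yes _  | yᵢ∈U = yᵢ∈U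
    ... | no i≢i | _    = ⊥-elim (i≢i refl)

  BoxNbhd-preimage : ∀ {k m} (g : (Fin k → A) → Fin m → A) (x : Fin k → A) →
                     (∀ l → ContinuousAt (λ y → g y l) x) →
                     ∀ {S} → BoxNbhd (g x) S → BoxNbhd x (λ y → S (g y))
  BoxNbhd-preimage {m = m} g x gₗ-cont (W , open-W , gx∈W , W⊆S) =
    BoxNbhd-mono (λ y gy∈W → W⊆S (g y) gy∈W)
      (BoxNbhd-⋂ m (λ l y → W l (g y l))
        (λ l → gₗ-cont l (W l) (open-W l) (gx∈W l)))

module _ {τ : Vocabulary} (𝔄 : Structure τ) (T : Topology (Carrier 𝔄))
         (rel-open : ∀ (R : RelSym τ) → ProdOpen T (relAr τ R) (relI 𝔄 R))
         (fun-cont : ∀ (f : FunSym τ) → Continuous T (funI 𝔄 f)) where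

  eval-continuousAt : ∀ {k} (t : Term τ k) (ρ : Fin k → Carrier 𝔄) →
                      ContinuousAt T (λ y → eval 𝔄 y t) ρ
  eval-continuousAt (var i)    ρ = projection-continuousAt T i ρ
  eval-continuousAt (app f ts) ρ U open-U fρ∈U =
    BoxNbhd-preimage T (λ y l → eval 𝔄 y (ts l)) ρ
      (λ l → eval-continuousAt (ts l) ρ)
      (fun-cont f U open-U _ fρ∈U)

  Sat-open : ∀ {k} (φ : ExFormula τ k) → ProdOpen T k (Sat 𝔄 φ)
  Sat-open (atom R ts) ρ sat =
    BoxNbhd-preimage T (λ y l → eval 𝔄 y (ts l)) ρ
      (λ l → eval-continuousAt (ts l) ρ)
      (rel-open R _ sat)
  Sat-open (φ ∧ ψ) ρ (sat-φ , sat-ψ) = BoxNbhd-∩ T (Sat-open φ ρ sat-φ) (Sat-open ψ ρ sat-ψ)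
  Sat-open (φ ∨ ψ) ρ (inj₁ sat-φ)    = BoxNbhd-mono T (λ _ → inj₁) (Sat-open φ ρ sat-φ)
  Sat-open (φ ∨ ψ) ρ (inj₂ sat-ψ)    = BoxNbhd-mono T (λ _ → inj₂) (Sat-open ψ ρ sat-ψ)
  Sat-open (ex φ)  ρ (a , sat-φ)     =
    BoxNbhd-mono T (λ _ → a ,_) (BoxNbhd-section T (Sat-open φ (a ∷ ρ) sat-φ))

dense-meets-ProdOpen : ∀ {A} (T : Topology A) {D : Subset A} → Dense T D →
                       ∀ {k} {U : Subset (Fin k → A)} → ProdOpen T k U →
                       Σ (Fin k → A) U → Σ (Fin k → A) λ d → (∀ i → D (d i)) × U d
dense-meets-ProdOpen {A} T {D} dense open-U (x , x∈U) with open-U x x∈U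
... | V , open-V , x∈V , V⊆U =
  (λ i → proj₁ (dᵢ i)) , (λ i → proj₁ (proj₂ (dᵢ i))) ,
  V⊆U _ (λ i → proj₂ (proj₂ (dᵢ i)))
  where
  dᵢ : ∀ i → Σ A λ d → D d × V i d
  dᵢ i = dense (V i) (open-V i) (x i , x∈V i)

lemma7 : (τ : Vocabulary) (𝔄 : Structure τ) (T : Topology (Carrier 𝔄))
    → (∀ (R : RelSym τ) → ProdOpen T (relAr τ R) (relI 𝔄 R))
    → (∀ (f : FunSym τ) → Continuous T (funI 𝔄 f))
    → (D : Subset (Carrier 𝔄)) → Dense T D
    → (k : ℕ) (φ : ExFormula τ k)
    → (Σ (Fin k → Carrier 𝔄) λ a → Sat 𝔄 φ a)
    ⇔ (Σ (Fin k → Carrier 𝔄) λ a → (∀ i → D (a i)) × Sat 𝔄 φ a)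
lemma7 τ 𝔄 T rel-open fun-cont D dense k φ =
  mk⇔ (dense-meets-ProdOpen T dense (Sat-open 𝔄 T rel-open fun-cont φ))
      (λ (a , _ , sat) → a , sat)
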